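{- For every positive integer $s$ there is a constant $c$ (depending only on $s$) such that the following holds. Let $G$ be a bipartite graph with bipartition $(A,B)$ which contains no induced subgraph isomorphic to $K_{1,s}\mathbin{\dot\cup}K_{1,s}$ whose two centers lie in the same bipartition class, and color the vertices of $A$ with one color and those of $B$ with another. Then the coloring produced from this by naive vertex refinement has color valence at most $c$. In particular this holds for every bipartite graph with no induced $K_{1,s}\mathbin{\dot\cup}K_{1,s}$.
   Context: $K_{1,s}$ is the star with $s$ leaves; its center is the vertex of degree $s$; $\dot\cup$ is disjoint union. Naive vertex refinement (1-dimensional Weisfeiler–Lehman) repeatedly refines a vertex coloring by splitting color classes according to the multiset of colors among neighbors, until stable; in the stable coloring, the number of neighbors a vertex $v$ has in a color class $C$ depends only on the color of $v$ and on $C$. A colored graph has color valence at most $k$ if for every vertex $v$ and every color class $C$, $v$ has at most $k$ neighbors or at most $k$ non-neighbors in $C$. -}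

module Defs where

open import Data.Nat using (ℕ; zero; suc; _≡ᵇ_; _≤_)
open import Data.Bool using (Bool; true; false; _∧_; not)
open import Data.Fin using (Fin)
open import Data.Fin.Properties using (_≟_)
open import Data.Maybe using (Maybe; just; nothing)
open import Data.Product using (_×_; _,_; ∃)
open import Data.Sum using (_⊎_)
open import Data.List using (List; []; _∷_; length; filterᵇ)
open import Data.List using () renaming (allFin to allFinL)
open import Data.Empty using (⊥)
open import Relation.Nullary using (¬_; does)
open import Relation.Binary.PropositionalEquality using (_≡_; _≢_)
open import Function.Definitions using (Injective)

allᵇ : {A : Set} → (A → Bool) → List A → Bool
allᵇ p [] = true
allᵇ p (x ∷ xs) = p x ∧ allᵇ p xs

_==_ : Bool → Bool → Bool
true  == b = b
false == b = not b

-- A finite simple bipartite graph on vertex set Fin n, with bipartition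
-- given by side : Fin n → Bool (A = side false, B = side true).
record BipGraph (n : ℕ) : Set where
  field
    adj     : Fin n → Fin n → Bool
    side    : Fin n → Bool
    adj-sym : ∀ v w → adj v w ≡ adj w v
    adj-bip : ∀ v w → adj v w ≡ true → side v ≢ side w
open BipGraph public

count : {n : ℕ} → (Fin n → Bool) → ℕ
count {n} p = length (filterᵇ p (allFinL n))

-- Naive vertex refinement: (refine G k v w) = true iff v and w get the
-- same colour after k refinement rounds, starting from the colouring by sides.
refine : {n : ℕ} → BipGraph n → ℕ → Fin n → Fin n → Bool
nbrCount : {n : ℕ} → BipGraph n → ℕ → Fin n → Fin n → ℕ

refine G zero v w = side G v == side G w
refine {n} G (suc k) v w =
  refine G k v w ∧ allᵇ (λ u → nbrCount G k v u ≡ᵇ nbrCount G k w u) (allFinL n)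

nbrCount G k v u = count (λ x → adj G v x ∧ refine G k x u)

-- The stable colouring: after n rounds on an n-vertex graph refinement has
-- stabilised (the number of classes strictly increases until stability).
stable : {n : ℕ} → BipGraph n → Fin n → Fin n → Bool
stable {n} G = refine G n

ColorValence≤ : {n : ℕ} → BipGraph n → ℕ → Set
ColorValence≤ G c = ∀ v u →
  count (λ x → adj G v x ∧ stable G x u) ≤ c ⊎
  count (λ x → not (adj G v x) ∧ stable G x u) ≤ c

-- Vertices of K_{1,s} ∪̇ K_{1,s}: (i , nothing) is the centre of star i,
-- (i , just j) is the j-th leaf of star i.
StarPairV : ℕ → Set
StarPairV s = Fin 2 × Maybe (Fin s)

starPairAdj : {s : ℕ} → StarPairV s → StarPairV s → Bool
starPairAdj (i , nothing) (i' , just _) = does (i ≟ i')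
starPairAdj (i , just _) (i' , nothing) = does (i ≟ i')
starPairAdj _ _ = false

HasInducedStarPairSameSide : {n : ℕ} → BipGraph n → ℕ → Set
HasInducedStarPairSameSide {n} G s =
  ∃ λ (f : StarPairV s → Fin n) →
    Injective _≡_ _≡_ f ×
    (∀ p q → adj G (f p) (f q) ≡ starPairAdj p q) ×
    side G (f (Fin.zero , nothing)) ≡ side G (f (Fin.suc Fin.zero , nothing))

module Submission where

-- Write s = t + 1 and fix vertices v and u with stable colour classes C_v and
-- C_u.  Let a and b be the numbers of neighbours and non-neighbours of v in
-- C_u (so |C_u| = a + b), p = |C_v|, and e the number of neighbours that u
-- (hence, by equitability, every vertex of C_u) has in C_v.
--   1. Naive refinement is stable after n rounds, because the number of
--      colour classes grows strictly until nothing changes; hence the stable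
--      colouring is equitable (module Refinement).
--   2. A vertex x ∈ C_v has at most t "private" neighbours in C_u, i.e. ones
--      that are not neighbours of v: x and v have equally many neighbours in
--      C_u, so otherwise v also has s private neighbours w.r.t. x, and the two
--      stars centred at x and v form a forbidden induced subgraph
--      (star-pair-from-private-neighbours).
--   3. Double counting edges gives p·a = (a+b)·e and b·e ≤ p·t; hence
--      a·b ≤ t·(a+b) (product-bound), which forces a ≤ 2t or b ≤ 2t
--      (small-factor).

open import Defs
open import Algebra.Bundles using (CommutativeMonoid)
open import Data.Bool using (Bool; true; false; _∧_; not; T; T?)
open import Data.Bool.Properties
  using (∧-commutativeMonoid; ∧-conicalˡ; ∧-conicalʳ; ∧-assoc; ∧-idem; T-≡) renaming (_≟_ to _≟ᵇ_)
open import Data.Bool.Solver using (module ∨-∧-Solver)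
open import Data.Empty using (⊥-elim)
open import Data.Fin using (Fin; toℕ) renaming (zero to fz; suc to fs)
open import Data.Fin.Properties using (toℕ-injective; all?; ¬∀⟶∃¬) renaming (_≟_ to _≟ᶠ_)
open import Data.List using (List; []; _∷_; length; filterᵇ; map) renaming (allFin to allFinL)
open import Data.List.Membership.Propositional using (_∈_)
open import Data.List.Membership.Propositional.Properties using (∈-allFin; ∈-filter⁻)
open import Data.List.Properties using (length-tabulate; map-cong)
import Data.List.Relation.Unary.All as All
open import Data.List.Relation.Unary.AllPairs using (_∷_)
open import Data.List.Relation.Unary.Any using (here; there)
open import Data.List.Relation.Unary.Unique.Propositional using (Unique)
open import Data.List.Relation.Unary.Unique.Propositional.Properties using (filter⁺; allFin⁺)
open import Data.Maybe using (just; nothing)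
open import Data.Nat
  using (ℕ; zero; suc; _+_; _*_; _∸_; _≤_; _<_; z≤n; s≤s; z<s; _≡ᵇ_; _<ᵇ_; _≤?_; >-nonZero)
open import Data.Nat.ListAction using (sum)
open import Data.Nat.Properties
open import Data.Nat.Tactic.RingSolver using (solve-∀)
open import Data.Product using (Σ; ∃; _×_; _,_; proj₁; proj₂)
open import Data.Sum using (_⊎_; inj₁; inj₂)
open import Data.Unit using (tt)
open import Function using (_∘_)
open import Function.Bundles using (Equivalence)
open import Function.Definitions using (Injective)
open import Relation.Binary.Definitions using (tri<; tri≈; tri>)
open import Relation.Binary.PropositionalEquality
open import Relation.Nullary using (¬_; Dec; yes; no; does)
open import Algebra.Properties.CommutativeSemigroup +-commutativeSemigroup
  using () renaming (x∙yz≈y∙xz to +-exchange)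
open import Algebra.Properties.CommutativeSemigroup
    (CommutativeMonoid.commutativeSemigroup ∧-commutativeMonoid)
  using () renaming (x∙yz≈y∙xz to ∧-exchange; x∙yz≈z∙yx to ∧-reverse)

==-refl : ∀ b → (b == b) ≡ true
==-refl true  = refl
==-refl false = refl

==-sound : ∀ {a b} → (a == b) ≡ true → a ≡ b
==-sound {true}  {true}  _ = refl
==-sound {false} {false} _ = refl

≡ᵇ-sound : ∀ {m k} → (m ≡ᵇ k) ≡ true → m ≡ k
≡ᵇ-sound {m} {k} e = ≡ᵇ⇒≡ m k (Equivalence.from T-≡ e)

≡ᵇ-complete : ∀ {m k} → m ≡ k → (m ≡ᵇ k) ≡ true
≡ᵇ-complete {m} {k} e = Equivalence.to T-≡ (≡⇒≡ᵇ m k e)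

not-true : ∀ {b} → not b ≡ true → b ≡ false
not-true {false} _ = refl

∧-regroup : ∀ c d w z → (c ∧ d) ∧ (w ∧ z) ≡ z ∧ (c ∧ (w ∧ d))
∧-regroup = solve 4 (λ c d w z → (c :* d) :* (w :* z) := z :* (c :* (w :* d))) refl
  where open ∨-∧-Solver

countIn : {A : Set} → (A → Bool) → List A → ℕ
countIn p xs = length (filterᵇ p xs)

countIn-cong : {A : Set} {p q : A → Bool} (xs : List A) → (∀ x → p x ≡ q x) →
  countIn p xs ≡ countIn q xs
countIn-cong [] p≡q = refl
countIn-cong {p = p} {q} (x ∷ xs) p≡q with p x | q x | p≡q x
... | true  | .true  | refl = cong suc (countIn-cong xs p≡q)
... | false | .false | refl = countIn-cong xs p≡q

countIn-false : {A : Set} (xs : List A) → countIn (λ _ → false) xs ≡ 0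
countIn-false []       = refl
countIn-false (x ∷ xs) = countIn-false xs

countIn-split : {A : Set} (p q : A → Bool) (xs : List A) →
  countIn p xs ≡ countIn (λ x → q x ∧ p x) xs + countIn (λ x → not (q x) ∧ p x) xs
countIn-split p q [] = refl
countIn-split p q (x ∷ xs) with q x | p x
... | true  | true  = cong suc (countIn-split p q xs)
... | true  | false = countIn-split p q xs
... | false | true  = trans (cong suc (countIn-split p q xs)) (sym (+-suc _ _))
... | false | false = countIn-split p q xs

-- If P and Q hold equally often inside R, then P ∖ Q and Q ∖ P are equally
-- large inside R: the common part P ∩ Q cancels.
countIn-balance : {A : Set} (P Q R : A → Bool) (xs : List A) →
  countIn (λ y → P y ∧ R y) xs ≡ countIn (λ y → Q y ∧ R y) xs →
  countIn (λ y → not (Q y) ∧ (P y ∧ R y)) xs ≡ countIn (λ y → not (P y) ∧ (Q y ∧ R y)) xs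
countIn-balance P Q R xs same = +-cancelˡ-≡ (countIn (λ y → Q y ∧ (P y ∧ R y)) xs) _ _ (begin
    countIn (λ y → Q y ∧ (P y ∧ R y)) xs + countIn (λ y → not (Q y) ∧ (P y ∧ R y)) xs
      ≡⟨ countIn-split (λ y → P y ∧ R y) Q xs ⟨
    countIn (λ y → P y ∧ R y) xs
      ≡⟨ same ⟩
    countIn (λ y → Q y ∧ R y) xs
      ≡⟨ countIn-split (λ y → Q y ∧ R y) P xs ⟩
    countIn (λ y → P y ∧ (Q y ∧ R y)) xs + countIn (λ y → not (P y) ∧ (Q y ∧ R y)) xs
      ≡⟨ cong (_+ countIn (λ y → not (P y) ∧ (Q y ∧ R y)) xs)
              (countIn-cong xs (λ y → ∧-exchange (P y) (Q y) (R y))) ⟩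
    countIn (λ y → Q y ∧ (P y ∧ R y)) xs + countIn (λ y → not (P y) ∧ (Q y ∧ R y)) xs ∎)
  where open ≡-Reasoning

countIn-mono : {A : Set} {p q : A → Bool} (xs : List A) → (∀ x → p x ≡ true → q x ≡ true) →
  countIn p xs ≤ countIn q xs
countIn-mono [] p⇒q = z≤n
countIn-mono {p = p} {q} (x ∷ xs) p⇒q with p x in px | q x in qx
... | true  | true  = s≤s (countIn-mono xs p⇒q)
... | true  | false with () ← trans (sym (p⇒q x px)) qx
... | false | true  = m≤n⇒m≤1+n (countIn-mono xs p⇒q)
... | false | false = countIn-mono xs p⇒q

countIn-strict : {A : Set} {p q : A → Bool} (xs : List A) → (∀ x → p x ≡ true → q x ≡ true) →
  (z : A) → z ∈ xs → p z ≡ false → q z ≡ true → countIn p xs < countIn q xs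
countIn-strict {p = p} {q} (x ∷ xs) p⇒q z (here refl) pz qz rewrite pz | qz =
  s≤s (countIn-mono xs p⇒q)
countIn-strict {p = p} {q} (x ∷ xs) p⇒q z (there z∈xs) pz qz with p x in px | q x in qx
... | true  | true  = s≤s (countIn-strict xs p⇒q z z∈xs pz qz)
... | true  | false with () ← trans (sym (p⇒q x px)) qx
... | false | true  = m≤n⇒m≤1+n (countIn-strict xs p⇒q z z∈xs pz qz)
... | false | false = countIn-strict xs p⇒q z z∈xs pz qz

countIn-≤-length : {A : Set} (p : A → Bool) (xs : List A) → countIn p xs ≤ length xs
countIn-≤-length p [] = z≤n
countIn-≤-length p (x ∷ xs) with p x
... | true  = s≤s (countIn-≤-length p xs)
... | false = m≤n⇒m≤1+n (countIn-≤-length p xs)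

sum-zeros : {A : Set} (xs : List A) → sum (map (λ _ → 0) xs) ≡ 0
sum-zeros []       = refl
sum-zeros (x ∷ xs) = sum-zeros xs

column-sums-∷ : {A B : Set} (M : A → B → Bool) (x : A) (xs : List A) (ys : List B) →
  sum (map (λ y → countIn (λ x′ → M x′ y) (x ∷ xs)) ys)
    ≡ countIn (M x) ys + sum (map (λ y → countIn (λ x′ → M x′ y) xs) ys)
column-sums-∷ M x xs [] = refl
column-sums-∷ M x xs (y ∷ ys) with M x y
... | true  = cong suc (trans (cong (countIn (λ x′ → M x′ y) xs +_) (column-sums-∷ M x xs ys))
                              (+-exchange (countIn (λ x′ → M x′ y) xs) (countIn (M x) ys) _))
... | false = trans (cong (countIn (λ x′ → M x′ y) xs +_) (column-sums-∷ M x xs ys))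
                    (+-exchange (countIn (λ x′ → M x′ y) xs) (countIn (M x) ys) _)

double-counting : {A B : Set} (M : A → B → Bool) (xs : List A) (ys : List B) →
  sum (map (λ x → countIn (M x) ys) xs) ≡ sum (map (λ y → countIn (λ x → M x y) xs) ys)
double-counting M [] ys = sym (sum-zeros ys)
double-counting M (x ∷ xs) ys =
  trans (cong (countIn (M x) ys +_) (double-counting M xs ys)) (sym (column-sums-∷ M x xs ys))

sum-count-const : {A B : Set} (P : A → Bool) (Q : A → B → Bool) (ys : List B) (k : ℕ) (xs : List A) →
  (∀ x → P x ≡ true → countIn (Q x) ys ≡ k) →
  sum (map (λ x → countIn (λ y → P x ∧ Q x y) ys) xs) ≡ countIn P xs * k
sum-count-const P Q ys k [] rows = refl
sum-count-const P Q ys k (x ∷ xs) rows with P x in px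
... | true  = cong₂ _+_ (rows x px) (sum-count-const P Q ys k xs rows)
... | false = cong₂ _+_ (countIn-false ys) (sum-count-const P Q ys k xs rows)

sum-count-bounded : {A B : Set} (P : A → Bool) (Q : A → B → Bool) (ys : List B) (k : ℕ) (xs : List A) →
  (∀ x → P x ≡ true → countIn (Q x) ys ≤ k) →
  sum (map (λ x → countIn (λ y → P x ∧ Q x y) ys) xs) ≤ countIn P xs * k
sum-count-bounded P Q ys k [] rows = z≤n
sum-count-bounded P Q ys k (x ∷ xs) rows with P x in px
... | true  = +-mono-≤ (rows x px) (sum-count-bounded P Q ys k xs rows)
... | false rewrite countIn-false ys = sum-count-bounded P Q ys k xs rows

allᵇ-intro : {A : Set} (p : A → Bool) (xs : List A) → (∀ x → p x ≡ true) → allᵇ p xs ≡ true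
allᵇ-intro p []       all = refl
allᵇ-intro p (x ∷ xs) all rewrite all x = allᵇ-intro p xs all

allᵇ-elim : {A : Set} (p : A → Bool) (xs : List A) → allᵇ p xs ≡ true → ∀ x → x ∈ xs → p x ≡ true
allᵇ-elim p (y ∷ ys) all x (here refl)  = ∧-conicalˡ (p y) _ all
allᵇ-elim p (y ∷ ys) all x (there x∈ys) = allᵇ-elim p ys (∧-conicalʳ (p y) _ all) x x∈ys

allᵇ-allFin : {n : ℕ} (p : Fin n → Bool) → allᵇ p (allFinL n) ≡ true → ∀ x → p x ≡ true
allᵇ-allFin {n} p all x = allᵇ-elim p (allFinL n) all x (∈-allFin x)

allᵇ-counterexample : {A : Set} (p : A → Bool) (xs : List A) → allᵇ p xs ≡ false →
  ∃ λ x → p x ≡ false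
allᵇ-counterexample p (y ∷ ys) e with p y in py
... | true  = allᵇ-counterexample p ys e
... | false = y , py

allᵇ-cong : {A : Set} {p q : A → Bool} (xs : List A) → (∀ x → p x ≡ q x) → allᵇ p xs ≡ allᵇ q xs
allᵇ-cong []       p≡q = refl
allᵇ-cong (x ∷ xs) p≡q = cong₂ _∧_ (p≡q x) (allᵇ-cong xs p≡q)

extend : {A : Set} {s : ℕ} → A → (Fin s → A) → Fin (suc s) → A
extend a g fz     = a
extend a g (fs j) = g j

select-from : {A : Set} (xs : List A) → Unique xs → ∀ s → s ≤ length xs →
  Σ (Fin s → A) λ g → Injective _≡_ _≡_ g × (∀ j → g j ∈ xs)
select-from xs _ zero _ = (λ ()) , (λ { {()} }) , (λ ())
select-from (a ∷ as) (a∉as ∷ unique) (suc s) (s≤s s≤len) with select-from as unique s s≤len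
... | g , g-injective , g∈as = extend a g , (λ {i} {j} → injective i j) , member
  where
  injective : ∀ i j → extend a g i ≡ extend a g j → i ≡ j
  injective fz     fz     _  = refl
  injective fz     (fs j) eq = ⊥-elim (All.lookup a∉as (g∈as j) eq)
  injective (fs i) fz     eq = ⊥-elim (All.lookup a∉as (g∈as i) (sym eq))
  injective (fs i) (fs j) eq = cong fs (g-injective eq)
  member : ∀ j → extend a g j ∈ (a ∷ as)
  member fz     = here refl
  member (fs j) = there (g∈as j)

select : ∀ {n} (P : Fin n → Bool) s → s ≤ count P →
  Σ (Fin s → Fin n) λ g → Injective _≡_ _≡_ g × (∀ j → P (g j) ≡ true)
select {n} P s s≤count with select-from (filterᵇ P (allFinL n)) (filter⁺ (T? ∘ P) (allFin⁺ n)) s s≤count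
... | g , g-injective , g∈ =
  g , g-injective , λ j → Equivalence.to T-≡ (proj₂ (∈-filter⁻ (T? ∘ P) {xs = allFinL n} (g∈ j)))

module Refinement {n : ℕ} (G : BipGraph n) where

  private
    R : ℕ → Fin n → Fin n → Bool
    R = refine G
    vertices : List (Fin n)
    vertices = allFinL n

  refine-side : ∀ k x y → R k x y ≡ true → side G x ≡ side G y
  refine-side zero    x y e = ==-sound e
  refine-side (suc k) x y e = refine-side k x y (∧-conicalˡ _ _ e)

  refine-prev : ∀ k x y → R (suc k) x y ≡ true → R k x y ≡ true
  refine-prev k x y e = ∧-conicalˡ _ _ e

  refine-counts : ∀ k x y → R (suc k) x y ≡ true → ∀ w → nbrCount G k x w ≡ nbrCount G k y w
  refine-counts k x y e w =
    ≡ᵇ-sound (allᵇ-allFin (λ w → nbrCount G k x w ≡ᵇ nbrCount G k y w) (∧-conicalʳ (R k x y) _ e) w)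

  refine-next : ∀ k x y → R k x y ≡ true → (∀ w → nbrCount G k x w ≡ nbrCount G k y w) →
    R (suc k) x y ≡ true
  refine-next k x y e counts rewrite e = allᵇ-intro _ vertices (λ w → ≡ᵇ-complete (counts w))

  refine-refl : ∀ k x → R k x x ≡ true
  refine-refl zero    x = ==-refl (side G x)
  refine-refl (suc k) x = refine-next k x x (refine-refl k x) (λ w → refl)

  refine-sym : ∀ k x y → R k x y ≡ true → R k y x ≡ true
  refine-sym zero    x y e rewrite ==-sound {side G x} e = ==-refl (side G y)
  refine-sym (suc k) x y e =
    refine-next k y x (refine-sym k x y (refine-prev k x y e)) (λ w → sym (refine-counts k x y e w))

  refine-trans : ∀ k x y z → R k x y ≡ true → R k y z ≡ true → R k x z ≡ true
  refine-trans zero    x y z e₁ e₂ rewrite ==-sound {side G x} e₁ = e₂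
  refine-trans (suc k) x y z e₁ e₂ =
    refine-next k x z (refine-trans k x y z (refine-prev k x y e₁) (refine-prev k y z e₂))
      (λ w → trans (refine-counts k x y e₁ w) (refine-counts k y z e₂ w))

  Stabilised : ℕ → Set
  Stabilised k = ∀ x y → R (suc k) x y ≡ R k x y

  stabilised-step : ∀ k → Stabilised k → Stabilised (suc k)
  stabilised-step k st x y = begin
    R (suc k) x y ∧ allᵇ (λ w → nbrCount G (suc k) x w ≡ᵇ nbrCount G (suc k) y w) vertices
      ≡⟨ cong (R (suc k) x y ∧_)
              (allᵇ-cong vertices (λ w → cong₂ _≡ᵇ_ (counts-agree x w) (counts-agree y w))) ⟩
    (R k x y ∧ checks) ∧ checks
      ≡⟨ ∧-assoc (R k x y) checks checks ⟩
    R k x y ∧ (checks ∧ checks)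
      ≡⟨ cong (R k x y ∧_) (∧-idem checks) ⟩
    R k x y ∧ checks ∎
    where
    open ≡-Reasoning
    checks : Bool
    checks = allᵇ (λ w → nbrCount G k x w ≡ᵇ nbrCount G k y w) vertices
    counts-agree : ∀ z w → nbrCount G (suc k) z w ≡ nbrCount G k z w
    counts-agree z w = countIn-cong vertices (λ z′ → cong (adj G z z′ ∧_) (st z′ w))

  stabilised-later : ∀ k → Stabilised k → ∀ m → Stabilised (m + k)
  stabilised-later k st zero    = st
  stabilised-later k st (suc m) = stabilised-step (m + k) (stabilised-later k st m)

  -- The leader of a round-k class is its member of least index; the number of
  -- leaders is the number of classes.
  isLeader : ℕ → Fin n → Bool
  isLeader k x = allᵇ (λ y → not ((toℕ y <ᵇ toℕ x) ∧ R k y x)) vertices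

  classCount : ℕ → ℕ
  classCount k = count (isLeader k)

  leader-below : ∀ k bound x → toℕ x < bound → ∃ λ r → isLeader k r ≡ true × R k r x ≡ true
  leader-below k (suc bound) x x<bound with isLeader k x in leads
  ... | true  = x , leads , refine-refl k x
  ... | false with allᵇ-counterexample _ vertices leads
  ... | y , _ with toℕ y <ᵇ toℕ x in y<x | R k y x in y∼x
  ... | true | true
        with leader-below k bound y (≤-trans (<ᵇ⇒< _ _ (subst T (sym y<x) tt)) (≤-pred x<bound))
  ... | r , leader , r∼y = r , leader , refine-trans k r y x r∼y y∼x

  leader : ∀ k x → ∃ λ r → isLeader k r ≡ true × R k r x ≡ true
  leader k x = leader-below k (suc (toℕ x)) x ≤-refl

  leader-least : ∀ k x r → isLeader k r ≡ true → toℕ x < toℕ r → R k x r ≡ false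
  leader-least k x r leads x<r = separated (toℕ x <ᵇ toℕ r) (<⇒<ᵇ x<r) (allᵇ-allFin _ leads x)
    where
    separated : ∀ c → T c → not (c ∧ R k x r) ≡ true → R k x r ≡ false
    separated true _ = not-true

  leader-unique : ∀ k r r′ → isLeader k r ≡ true → isLeader k r′ ≡ true → R k r r′ ≡ true → r ≡ r′
  leader-unique k r r′ leads leads′ r∼r′ with <-cmp (toℕ r) (toℕ r′)
  ... | tri< r<r′ _ _ with () ← trans (sym r∼r′) (leader-least k r r′ leads′ r<r′)
  ... | tri≈ _ r≡r′ _ = toℕ-injective r≡r′
  ... | tri> _ _ r>r′ with () ← trans (sym (refine-sym k r r′ r∼r′)) (leader-least k r′ r leads r>r′)

  -- Classes only split, so a leader stays a leader.
  leader-persists : ∀ k x → isLeader k x ≡ true → isLeader (suc k) x ≡ true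
  leader-persists k x leads = allᵇ-intro _ vertices λ y → step y (allᵇ-allFin _ leads y)
    where
    step : ∀ y → not ((toℕ y <ᵇ toℕ x) ∧ R k y x) ≡ true →
           not ((toℕ y <ᵇ toℕ x) ∧ R (suc k) y x) ≡ true
    step y before with toℕ y <ᵇ toℕ x | R (suc k) y x in y∼x
    ... | false | _     = refl
    ... | true  | false = refl
    ... | true  | true rewrite refine-prev k y x y∼x = before

  -- If round k+1 separates two equivalent vertices, a new class (leader) appears.
  classCount-grows : ∀ k x y → R k x y ≡ true → R (suc k) x y ≡ false →
    classCount k < classCount (suc k)
  classCount-grows k x y x∼y x≁y with leader (suc k) x | leader (suc k) y
  ... | r , leads , r∼x | r′ , leads′ , r′∼y with isLeader k r in old | isLeader k r′ in old′
  ... | false | _     = countIn-strict vertices (leader-persists k) r (∈-allFin r) old leads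
  ... | true  | false = countIn-strict vertices (leader-persists k) r′ (∈-allFin r′) old′ leads′
  ... | true  | true with leader-unique k r r′ old old′
          (refine-trans k r x r′ (refine-prev k r x r∼x)
            (refine-trans k x y r′ x∼y (refine-sym k r′ y (refine-prev k r′ y r′∼y))))
  ... | refl with () ← trans (sym (refine-trans (suc k) x r y (refine-sym (suc k) r x r∼x) r′∼y)) x≁y

  classCount-≤ : ∀ k → classCount k ≤ n
  classCount-≤ k =
    subst (classCount k ≤_) (length-tabulate {n = n} (λ z → z)) (countIn-≤-length _ vertices)

  stabilised? : ∀ k → Dec (Stabilised k)
  stabilised? k = all? (λ x → all? (λ y → R (suc k) x y ≟ᵇ R k x y))

  split-pair : ∀ k → ¬ Stabilised k → ∃ λ x → ∃ λ y → R k x y ≡ true × R (suc k) x y ≡ false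
  split-pair k unstable with ¬∀⟶∃¬ n _ (λ x → all? (λ y → R (suc k) x y ≟ᵇ R k x y)) unstable
  ... | x , ¬all with ¬∀⟶∃¬ n _ (λ y → R (suc k) x y ≟ᵇ R k x y) ¬all
  ... | y , differ = x , y , finer-and-different (refine-prev k x y) differ
    where
    finer-and-different : ∀ {a b} → (b ≡ true → a ≡ true) → b ≢ a → a ≡ true × b ≡ false
    finer-and-different {true}  {true}  _   differ = ⊥-elim (differ refl)
    finer-and-different {true}  {false} _   _      = refl , refl
    finer-and-different {false} {true}  b⇒a _      with () ← b⇒a refl
    finer-and-different {false} {false} _   differ = ⊥-elim (differ refl)

  progress : ∀ j → (∃ λ k → k < j × Stabilised k) ⊎ j ≤ classCount j
  progress zero = inj₂ z≤n
  progress (suc j) with progress j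
  ... | inj₁ (k , k<j , st) = inj₁ (k , m<n⇒m<1+n k<j , st)
  ... | inj₂ j≤classes with stabilised? j
  ... | yes st = inj₁ (j , n<1+n j , st)
  ... | no unstable with split-pair j unstable
  ... | x , y , old , new = inj₂ (≤-trans (s≤s j≤classes) (classCount-grows j x y old new))

  -- There are at most n classes, so refinement has stabilised by round n.
  stabilised-by-n : Stabilised n
  stabilised-by-n with progress (suc n)
  ... | inj₂ too-many = ⊥-elim (1+n≰n (≤-trans too-many (classCount-≤ (suc n))))
  ... | inj₁ (k , k<1+n , st) =
    subst Stabilised (m∸n+n≡m (≤-pred k<1+n)) (stabilised-later k st (n ∸ k))

  stable-equitable : ∀ x y → stable G x y ≡ true → ∀ w → nbrCount G n x w ≡ nbrCount G n y w
  stable-equitable x y x∼y = refine-counts n x y (trans (stabilised-by-n x y) x∼y)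

  stable-refl : ∀ x → stable G x x ≡ true
  stable-refl = refine-refl n

  stable-side : ∀ x y → stable G x y ≡ true → side G x ≡ side G y
  stable-side = refine-side n

same-side-nonadjacent : ∀ {n} (G : BipGraph n) x y → side G x ≡ side G y → adj G x y ≡ false
same-side-nonadjacent G x y same with adj G x y in xy
... | true  = ⊥-elim (adj-bip G x y xy same)
... | false = refl

does-≟-sym : ∀ {m} (i j : Fin m) → does (i ≟ᶠ j) ≡ does (j ≟ᶠ i)
does-≟-sym i j with i ≟ᶠ j | j ≟ᶠ i
... | yes _   | yes _   = refl
... | no _    | no _    = refl
... | yes i≡j | no j≢i  = ⊥-elim (j≢i (sym i≡j))
... | no i≢j  | yes j≡i = ⊥-elim (i≢j (sym j≡i))

-- Injectivity of
-- the embedding comes for free from the adjacency pattern.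
module StarPair {n s : ℕ} (G : BipGraph n)
    (centre : Fin 2 → Fin n) (leaf : Fin 2 → Fin (suc s) → Fin n) {τ σ : Bool}
    (centre-side : ∀ i → side G (centre i) ≡ τ)
    (leaf-side : ∀ i j → side G (leaf i j) ≡ σ)
    (centre-leaf : ∀ i i′ j → adj G (centre i) (leaf i′ j) ≡ does (i ≟ᶠ i′))
    (leaf-injective : ∀ i → Injective _≡_ _≡_ (leaf i)) where

  embed : StarPairV (suc s) → Fin n
  embed (i , nothing) = centre i
  embed (i , just j)  = leaf i j

  embed-induced : ∀ p q → adj G (embed p) (embed q) ≡ starPairAdj p q
  embed-induced (i , nothing) (i′ , nothing) =
    same-side-nonadjacent G _ _ (trans (centre-side i) (sym (centre-side i′)))
  embed-induced (i , nothing) (i′ , just j) = centre-leaf i i′ j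
  embed-induced (i , just j) (i′ , nothing) =
    trans (adj-sym G (leaf i j) (centre i′)) (trans (centre-leaf i′ i j) (does-≟-sym i′ i))
  embed-induced (i , just j) (i′ , just j′) =
    same-side-nonadjacent G _ _ (trans (leaf-side i j) (sym (leaf-side i′ j′)))

  -- Distinct vertices of the star pair either are leaves of the same star or
  -- are told apart by their adjacency to some vertex r.
  embed-injective : Injective _≡_ _≡_ embed
  embed-injective {p} {q} same = separate p q same same-nbrs
    where
    same-nbrs : ∀ r → starPairAdj r p ≡ starPairAdj r q
    same-nbrs r = trans (sym (embed-induced r p)) (trans (cong (adj G (embed r)) same) (embed-induced r q))
    separate : ∀ p q → embed p ≡ embed q → (∀ r → starPairAdj r p ≡ starPairAdj r q) → p ≡ q
    separate (fz , nothing)    (fz , nothing)     _ _ = refl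
    separate (fs fz , nothing) (fs fz , nothing)  _ _ = refl
    separate (fz , just j)     (fz , just j′)     same _ = cong (λ k → fz , just k) (leaf-injective fz same)
    separate (fs fz , just j)  (fs fz , just j′)  same _ =
      cong (λ k → fs fz , just k) (leaf-injective (fs fz) same)
    separate (fz , nothing)    (fs fz , nothing)  _ nbrs with () ← nbrs (fz , just fz)
    separate (fs fz , nothing) (fz , nothing)     _ nbrs with () ← nbrs (fz , just fz)
    separate (i , just j)      (fz , nothing)     _ nbrs with () ← nbrs (fz , just fz)
    separate (i , just j)      (fs fz , nothing)  _ nbrs with () ← nbrs (fs fz , just fz)
    separate (fz , nothing)    (i , just j)       _ nbrs with () ← nbrs (fz , just fz)
    separate (fs fz , nothing) (i , just j)       _ nbrs with () ← nbrs (fs fz , just fz)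
    separate (fz , just j)     (fs fz , just j′)  _ nbrs with () ← nbrs (fz , nothing)
    separate (fs fz , just j)  (fz , just j′)     _ nbrs with () ← nbrs (fs fz , nothing)

  induced : HasInducedStarPairSameSide G (suc s)
  induced = embed , embed-injective , embed-induced , trans (centre-side fz) (sym (centre-side (fs fz)))

-- If x has s+1 neighbours in W
-- that are not neighbours of v, then (by countIn-balance) v has s+1 neighbours
-- in W that are not neighbours of x, and the two stars are induced.
star-pair-from-private-neighbours : ∀ {n s} (G : BipGraph n) (x v : Fin n) (W : Fin n → Bool) {σ : Bool} →
  side G x ≡ side G v → (∀ y → W y ≡ true → side G y ≡ σ) →
  count (λ y → adj G x y ∧ W y) ≡ count (λ y → adj G v y ∧ W y) →
  suc s ≤ count (λ y → not (adj G v y) ∧ (adj G x y ∧ W y)) →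
  HasInducedStarPairSameSide G (suc s)
star-pair-from-private-neighbours {n} {s} G x v W {σ} x∼v W-side same-degree many =
  StarPair.induced G centre leaf centre-side leaf-side centre-leaf leaf-injective
  where
  private-of : Fin n → Fin n → Fin n → Bool
  private-of c c′ y = not (adj G c′ y) ∧ (adj G c y ∧ W y)

  private₀ = select (private-of x v) (suc s) many
  private₁ = select (private-of v x) (suc s)
    (subst (suc s ≤_) (countIn-balance (adj G x) (adj G v) W (allFinL n) same-degree) many)

  centre : Fin 2 → Fin n
  centre fz      = x
  centre (fs fz) = v

  leaf : Fin 2 → Fin (suc s) → Fin n
  leaf fz      = proj₁ private₀
  leaf (fs fz) = proj₁ private₁

  private₀-leaf : ∀ j → private-of x v (leaf fz j) ≡ true
  private₀-leaf = proj₂ (proj₂ private₀)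

  private₁-leaf : ∀ j → private-of v x (leaf (fs fz) j) ≡ true
  private₁-leaf = proj₂ (proj₂ private₁)

  private-adjacent : ∀ {c c′ y} → private-of c c′ y ≡ true → adj G c y ≡ true
  private-adjacent {c} {c′} {y} h = ∧-conicalˡ _ (W y) (∧-conicalʳ (not (adj G c′ y)) _ h)

  private-nonadjacent : ∀ {c c′ y} → private-of c c′ y ≡ true → adj G c′ y ≡ false
  private-nonadjacent h = not-true (∧-conicalˡ _ _ h)

  private-in-W : ∀ {c c′ y} → private-of c c′ y ≡ true → W y ≡ true
  private-in-W {c} {c′} {y} h = ∧-conicalʳ (adj G c y) _ (∧-conicalʳ (not (adj G c′ y)) _ h)

  centre-side : ∀ i → side G (centre i) ≡ side G v
  centre-side fz      = x∼v
  centre-side (fs fz) = refl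

  leaf-side : ∀ i j → side G (leaf i j) ≡ σ
  leaf-side fz      j = W-side _ (private-in-W (private₀-leaf j))
  leaf-side (fs fz) j = W-side _ (private-in-W (private₁-leaf j))

  centre-leaf : ∀ i i′ j → adj G (centre i) (leaf i′ j) ≡ does (i ≟ᶠ i′)
  centre-leaf fz      fz      j = private-adjacent (private₀-leaf j)
  centre-leaf fz      (fs fz) j = private-nonadjacent (private₁-leaf j)
  centre-leaf (fs fz) fz      j = private-nonadjacent (private₀-leaf j)
  centre-leaf (fs fz) (fs fz) j = private-adjacent (private₁-leaf j)

  leaf-injective : ∀ i → Injective _≡_ _≡_ (leaf i)
  leaf-injective fz      = proj₁ (proj₂ private₀)
  leaf-injective (fs fz) = proj₁ (proj₂ private₁)

private
  reassoc₁ : ∀ t a b → (t + t) * (a + b) + (a + b) ≡ a * suc (t + t) + b * suc (t + t)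
  reassoc₁ = solve-∀
  reassoc₂ : ∀ t a b → t * (a + b) + t * (a + b) ≡ (t + t) * (a + b)
  reassoc₂ = solve-∀
  reassoc₃ : ∀ p a b → p * (a * b) ≡ b * (p * a)
  reassoc₃ = solve-∀
  reassoc₄ : ∀ a b e → b * ((a + b) * e) ≡ (a + b) * (b * e)
  reassoc₄ = solve-∀
  reassoc₅ : ∀ a b p t → (a + b) * (p * t) ≡ p * (t * (a + b))
  reassoc₅ = solve-∀

-- If a·b ≤ t·(a+b) then one factor is at most 2t: otherwise
-- 2t(a+b) + (a+b) ≤ 2ab ≤ 2t(a+b).
small-factor : ∀ t a b → a * b ≤ t * (a + b) → a ≤ t + t ⊎ b ≤ t + t
small-factor t a b ab≤ with a ≤? t + t | b ≤? t + t
... | yes a≤ | _      = inj₁ a≤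
... | no _   | yes b≤ = inj₂ b≤
... | no a≰  | no b≰  = ⊥-elim (<-irrefl refl (begin-strict
    (t + t) * (a + b)                      <⟨ m<m+n _ (<-≤-trans z<s (≤-trans (≰⇒> a≰) (m≤m+n a b))) ⟩
    (t + t) * (a + b) + (a + b)            ≡⟨ reassoc₁ t a b ⟩
    a * suc (t + t) + b * suc (t + t)      ≤⟨ +-mono-≤ (*-monoʳ-≤ a (≰⇒> b≰)) (*-monoʳ-≤ b (≰⇒> a≰)) ⟩
    a * b + b * a                          ≡⟨ cong (a * b +_) (*-comm b a) ⟩
    a * b + a * b                          ≤⟨ +-mono-≤ ab≤ ab≤ ⟩
    t * (a + b) + t * (a + b)              ≡⟨ reassoc₂ t a b ⟩
    (t + t) * (a + b)                      ∎))
  where open ≤-Reasoning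

-- From p·a = (a+b)·e and b·e ≤ p·t with p > 0:  p·a·b = (a+b)·b·e ≤ (a+b)·p·t.
product-bound : ∀ t a b p e → 0 < p → p * a ≡ (a + b) * e → b * e ≤ p * t → a * b ≤ t * (a + b)
product-bound t a b p e p>0 pa≡qe be≤pt = *-cancelˡ-≤ p {{>-nonZero p>0}} (begin
  p * (a * b)        ≡⟨ reassoc₃ p a b ⟩
  b * (p * a)        ≡⟨ cong (b *_) pa≡qe ⟩
  b * ((a + b) * e)  ≡⟨ reassoc₄ a b e ⟩
  (a + b) * (b * e)  ≤⟨ *-monoʳ-≤ (a + b) be≤pt ⟩
  (a + b) * (p * t)  ≡⟨ reassoc₅ a b p t ⟩
  p * (t * (a + b))  ∎)
  where open ≤-Reasoning

module ColourValenceBound (t : ℕ) {n : ℕ} (G : BipGraph n)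
    (no-star-pair : ¬ HasInducedStarPairSameSide G (suc t)) (v u : Fin n) where

  open Refinement G using (stable-equitable; stable-refl; stable-side)

  private
    vertices : List (Fin n)
    vertices = allFinL n

  inV inU : Fin n → Bool
  inV x = stable G x v
  inU y = stable G y u

  a b p e : ℕ
  a = count (λ y → adj G v y ∧ inU y)
  b = count (λ y → not (adj G v y) ∧ inU y)
  p = count inV
  e = count (λ x → adj G u x ∧ inV x)

  privateNbr : Fin n → Fin n → Bool
  privateNbr x y = not (adj G v y) ∧ (adj G x y ∧ inU y)

  private-bound : ∀ x → inV x ≡ true → count (privateNbr x) ≤ t
  private-bound x x∼v with count (privateNbr x) ≤? t
  ... | yes few = few
  ... | no many = ⊥-elim (no-star-pair (star-pair-from-private-neighbours G x v inU
          (stable-side x v x∼v) (λ y y∼u → stable-side y u y∼u) (stable-equitable x v x∼v u) (≰⇒> many)))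

  class-nonempty : 0 < p
  class-nonempty = subst (_< p) (countIn-false vertices)
    (countIn-strict vertices (λ _ ()) v (∈-allFin v) refl (stable-refl v))

  class-size : count inU ≡ a + b
  class-size = countIn-split inU (adj G v) vertices

  edges-between-classes : p * a ≡ (a + b) * e
  edges-between-classes = begin
    p * a
      ≡⟨ sum-count-const inV (λ x y → adj G x y ∧ inU y) vertices a vertices
           (λ x x∼v → stable-equitable x v x∼v u) ⟨
    sum (map (λ x → countIn (λ y → inV x ∧ (adj G x y ∧ inU y)) vertices) vertices)
      ≡⟨ double-counting (λ x y → inV x ∧ (adj G x y ∧ inU y)) vertices vertices ⟩
    sum (map (λ y → countIn (λ x → inV x ∧ (adj G x y ∧ inU y)) vertices) vertices)
      ≡⟨ cong sum (map-cong (λ y → countIn-cong vertices (λ x → flip-edge x y)) vertices) ⟩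
    sum (map (λ y → countIn (λ x → inU y ∧ (adj G y x ∧ inV x)) vertices) vertices)
      ≡⟨ sum-count-const inU (λ y x → adj G y x ∧ inV x) vertices e vertices
           (λ y y∼u → stable-equitable y u y∼u v) ⟩
    count inU * e
      ≡⟨ cong (_* e) class-size ⟩
    (a + b) * e ∎
    where
    open ≡-Reasoning
    flip-edge : ∀ x y → inV x ∧ (adj G x y ∧ inU y) ≡ inU y ∧ (adj G y x ∧ inV x)
    flip-edge x y = trans (cong (λ c → inV x ∧ (c ∧ inU y)) (adj-sym G x y))
                          (∧-reverse (inV x) (adj G y x) (inU y))

  -- Edges from C_v to the non-neighbours of v in C_u: each such vertex sees
  -- e of them, each x ∈ C_v at most t (its private neighbours).
  edges-to-non-neighbours : b * e ≤ p * t
  edges-to-non-neighbours = begin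
    b * e
      ≡⟨ sum-count-const (λ y → not (adj G v y) ∧ inU y) (λ y x → adj G y x ∧ inV x) vertices e vertices
           (λ y y∈ → stable-equitable y u (∧-conicalʳ (not (adj G v y)) _ y∈) v) ⟨
    sum (map (λ y → countIn (λ x → (not (adj G v y) ∧ inU y) ∧ (adj G y x ∧ inV x)) vertices) vertices)
      ≡⟨ cong sum (map-cong (λ y → countIn-cong vertices (λ x → flip-edge x y)) vertices) ⟩
    sum (map (λ y → countIn (λ x → inV x ∧ privateNbr x y) vertices) vertices)
      ≡⟨ double-counting (λ x y → inV x ∧ privateNbr x y) vertices vertices ⟨
    sum (map (λ x → countIn (λ y → inV x ∧ privateNbr x y) vertices) vertices)
      ≤⟨ sum-count-bounded inV privateNbr vertices t vertices private-bound ⟩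
    p * t ∎
    where
    open ≤-Reasoning
    flip-edge : ∀ x y → (not (adj G v y) ∧ inU y) ∧ (adj G y x ∧ inV x) ≡ inV x ∧ privateNbr x y
    flip-edge x y = trans (cong (λ c → (not (adj G v y) ∧ inU y) ∧ (c ∧ inV x)) (adj-sym G y x))
                          (∧-regroup (not (adj G v y)) (inU y) (adj G x y) (inV x))

  valence-bound : a ≤ t + t ⊎ b ≤ t + t
  valence-bound = small-factor t a b
    (product-bound t a b p e class-nonempty edges-between-classes edges-to-non-neighbours)

theorem11 : (s : ℕ) → 1 ≤ s → ∃ λ (c : ℕ) → ∀ (n : ℕ) (G : BipGraph n) →
    ¬ HasInducedStarPairSameSide G s → ColorValence≤ G c
theorem11 (suc t) _ =
  t + t , λ n G no-star-pair v u → ColourValenceBound.valence-bound t G no-star-pair v u
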